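{- The expected competitive ratio of the randomized online algorithm $\mathrm{gCHASE}_s^r$ for problem SP is $2$. Here $\mathrm{gCHASE}_s^r$ sets $s_0\leftarrow 0$ and, for $t=1,\dots,T$, upon receiving $\sigma_t$ computes $\Delta(t)$ and: if $\Delta(t)=0$ sets $s_t\leftarrow1$; else if $\Delta(t)=-\beta$ sets $s_t\leftarrow0$; otherwise, if $\Delta(t-1)\le\Delta(t)$: when $s_{t-1}=1$ it sets $s_t\leftarrow1$, and when $s_{t-1}=0$ it sets $s_t\leftarrow0$ with probability $\Delta(t)/\Delta(t-1)$ and $s_t\leftarrow1$ with probability $1-\Delta(t)/\Delta(t-1)$; and if $\Delta(t-1)>\Delta(t)$: when $s_{t-1}=0$ it sets $s_t\leftarrow0$, and when $s_{t-1}=1$ it sets $s_t\leftarrow0$ with probability $1-\frac{\beta+\Delta(t)}{\beta+\Delta(t-1)}$ and $s_t\leftarrow1$ with probability $\frac{\beta+\Delta(t)}{\beta+\Delta(t-1)}$.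
   Context: Fix a horizon $T\in\mathbb{N}$, a constant cancellation fee $\beta>0$ and a constant $H$. At each time $t\in\{1,\dots,T\}$ an input $\sigma_t=(e_t,p^0_t,p^1_t,B_t)$ determines a cost function $g_t:\{0,1\}\to\mathbb{R}$ by $g_t(1)=e_t p^1_t$ and $g_t(0)=e_t p^0_t+(p^1_t-p^0_t)(e_t-1.1B_t)^+-H(0.9B_t-e_t)^+$, where $(x)^+=\max\{x,0\}$; these cost functions are taken to be nonnegative. Problem SP: given $\boldsymbol{\sigma}=(\sigma_1,\dots,\sigma_T)$, minimize $\mathrm{Cost}(\boldsymbol{s})=\sum_{t=1}^T\big(g_t(s_t)+\beta(s_t-s_{t-1})^+\big)$ over $(s_1,\dots,s_T)\in\{0,1\}^T$, with initial state $s_0=0$; $\mathrm{Opt}(s_0,\boldsymbol{\sigma})$ is the optimal value. Define $\delta(t)=g_t(0)-g_t(1)$, $\Delta(0)=-\beta$, $\Delta(t)=\min\{0,\max\{\Delta(t-1)+\delta(t),-\beta\}\}$ for $t\ge1$. A randomized online algorithm $\mathcal{A}$ chooses each $s_t$ (possibly at random) based only on $\sigma_1,\dots,\sigma_t$ and its past random choices; its expected competitive ratio is the smallest $c$ such that there is a constant $\gamma(s_0)$ depending only on $s_0$ with $\mathbb{E}[\mathrm{Cost}_{\mathcal{A}}(s_0,\boldsymbol{\sigma})]\le c\cdot\mathrm{Opt}(s_0,\boldsymbol{\sigma})+\gamma(s_0)$ for all input sequences $\boldsymbol{\sigma}$, the expectation being over the algorithm's random choices.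
   Formalization: The fee β, the constant H and the inputs $\sigma_t$ are rational, and the constants c and $\gamma(s_0)$ in the definition of the expected competitive ratio are taken in ℚ. -}

module Defs where

open import Data.Bool using (Bool; true; false)
open import Data.Nat using (ℕ; zero; suc)
open import Data.Integer using (+_)
open import Data.List using (List; []; _∷_; [_]; map; _++_; length; replicate; foldr; concatMap)
open import Data.List.Relation.Unary.All using (All)
open import Data.Product using (_×_; _,_; ∃-syntax)
open import Data.Rational using (ℚ; 0ℚ; 1ℚ; _+_; _*_; _-_; -_; _÷_; _⊓_; _⊔_; _≤_; _<_; _/_; ≢-nonZero)
open import Data.Rational.Properties using (_≟_; _≤?_)
open import Relation.Nullary using (¬_; yes; no)

pos : ℚ → ℚ
pos x = x ⊔ 0ℚ

-- total division; only ever used with a nonzero divisor in the algorithm below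
_/'_ : ℚ → ℚ → ℚ
p /' q with q ≟ 0ℚ
... | yes _ = 0ℚ
... | no q≢0 = _÷_ p q {{≢-nonZero q≢0}}

record Input : Set where
  constructor input
  field
    e  : ℚ
    p0 : ℚ
    p1 : ℚ
    B  : ℚ
open Input public

module SP (β H : ℚ) where

  g1 : Input → ℚ
  g1 σ = e σ * p1 σ

  g0 : Input → ℚ
  g0 σ = e σ * p0 σ + (p1 σ - p0 σ) * pos (e σ - (+ 11 / 10) * B σ)
         - H * pos ((+ 9 / 10) * B σ - e σ)

  g : Input → Bool → ℚ
  g σ true  = g1 σ
  g σ false = g0 σ

  Nonneg : Input → Set
  Nonneg σ = (0ℚ ≤ g0 σ) × (0ℚ ≤ g1 σ)

  switch : Bool → Bool → ℚ
  switch false true = β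
  switch _     _    = 0ℚ

  cost : Bool → List Input → List Bool → ℚ
  cost prev (σ ∷ σs) (s ∷ ss) = g σ s + switch prev s + cost s σs ss
  cost prev _        _        = 0ℚ

  schedules : ℕ → List (List Bool)
  schedules zero    = [ [] ]
  schedules (suc n) = map (false ∷_) (schedules n) ++ map (true ∷_) (schedules n)

  Opt : List Input → ℚ
  Opt σs = foldr _⊓_ (cost false σs (replicate (length σs) false))
                     (map (cost false σs) (schedules (length σs)))

  δ : Input → ℚ
  δ σ = g0 σ - g1 σ

  Δnext : ℚ → Input → ℚ
  Δnext Δp σ = 0ℚ ⊓ ((Δp + δ σ) ⊔ (- β))

  -- finite probability distributions: lists of (probability, outcome)
  Dist : Set → Set
  Dist A = List (ℚ × A)

  -- one step of gCHASE_s^r: given Δ(t-1), Δ(t) and s_{t-1}, the law of s_t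
  step : ℚ → ℚ → Bool → Dist Bool
  step Δp Δc s with Δc ≟ 0ℚ
  ... | yes _ = [ (1ℚ , true) ]
  ... | no _ with Δc ≟ (- β)
  ...   | yes _ = [ (1ℚ , false) ]
  ...   | no _ with Δp ≤? Δc
  ...     | yes _ with s
  ...       | true  = [ (1ℚ , true) ]
  ...       | false = (Δc /' Δp , false) ∷ (1ℚ - Δc /' Δp , true) ∷ []
  step Δp Δc s | no _ | no _ | no _ with s
  ...       | false = [ (1ℚ , false) ]
  ...       | true  = (1ℚ - (β + Δc) /' (β + Δp) , false)
                      ∷ ((β + Δc) /' (β + Δp) , true) ∷ []

  -- law of the whole schedule (s_t, …, s_T) given Δ(t-1) and s_{t-1}
  run : ℚ → Bool → List Input → Dist (List Bool)
  run Δp s []       = [ (1ℚ , []) ]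
  run Δp s (σ ∷ σs) =
    concatMap (λ { (p , s') → map (λ { (q , ss) → (p * q , s' ∷ ss) })
                                  (run (Δnext Δp σ) s' σs) })
              (step Δp (Δnext Δp σ) s)

  ExpCost : List Input → ℚ
  ExpCost σs = foldr _+_ 0ℚ (map (λ { (p , ss) → p * cost false σs ss })
                                 (run (- β) false σs))

  Competitive : ℚ → Set
  Competitive c = ∃[ γ ] ((σs : List Input) → All Nonneg σs →
                          ExpCost σs ≤ c * Opt σs + γ)

  RatioIs : ℚ → Set
  RatioIs c = Competitive c × ((c' : ℚ) → c' < c → ¬ Competitive c')

module Submission where

open import Defs
open import Data.Integer using (+_)
open import Data.Rational using (ℚ; 0ℚ; _<_; _/_)
open import Data.Rational using (mkℚ; *<*; *≤*; 1ℚ; _≤_; _+_; _*_; _-_; -_; _⊓_; _⊔_; 1/_; >-nonZero; ≢-nonZero; nonNegative; positive)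
open import Data.Rational.Properties
open import Data.Bool using (Bool; true; false)
open import Data.Nat as ℕ using (ℕ; zero; suc)
import Data.Nat.Properties as ℕP
import Data.Integer as ℤ
import Data.Integer.Properties as ℤP
open import Data.Nat.Divisibility using (∣1⇒≡1)
open import Data.List using (List; []; _∷_; map; _++_; length; replicate; foldr; concatMap)
open import Data.List.Properties using (length-replicate)
open import Data.List.Relation.Unary.All using (All; []; _∷_)
import Data.List.Relation.Unary.All as All
open import Data.List.Relation.Unary.All.Properties using (map⁺; ++⁺; replicate⁺)
open import Data.Product using (_×_; _,_; proj₁; proj₂; ∃-syntax)
open import Data.Sum using (_⊎_; inj₁; inj₂)
open import Function using (_∘_; _∋_)
open import Level using (0ℓ)
open import Relation.Binary.PropositionalEquality
open import Relation.Nullary using (¬_; yes; no)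
open import Relation.Nullary.Decidable using (dec⇒maybe)
open import Data.Empty using (⊥-elim)
open import Tactic.RingSolver using (solve-∀; solve)
open import Tactic.RingSolver.Core.AlmostCommutativeRing using (AlmostCommutativeRing; fromCommutativeRing)

-- gCHASE keeps P[s_t = 1] = (β + Δ(t))/β, and each transition (`step`) couples the old
-- and new state so that the state switches on with probability (Δ(t) - Δ(t-1))^+/β only.
-- Hence β·E[Cost] equals `fracCost`, the cost of the deterministic fractional algorithm
-- x_t = 1 + Δ(t)/β (`βExpCost`).
--
-- Upper bound: with the potential Ψ(0, Δ) = (β + Δ)², Ψ(1, Δ) = (β - Δ)², one step of the
-- fractional algorithm against an offline state satisfies 2·fracStep + ΔΨ ≤ 4β·g(s')
-- (`potential-step`) and an offline switch costs at most 4β of potential (`potential-switch`);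
-- summing, E[Cost] ≤ 2·Cost(s) for every schedule s, hence ≤ 2·Opt (`upper`).
--
-- Lower bound: for ε = β/n the input of m rounds of n "rises" (g(0) = ε, g(1) = 0) and n
-- "falls" (g(0) = 0, g(1) = ε) has E[Cost] = m(2β - ε) (`ExpCost-zigzag`, by telescoping)
-- while staying in state 0 costs mβ; choosing n and then m large refutes any ratio c' < 2.

ℚ-ring : AlmostCommutativeRing 0ℓ 0ℓ
ℚ-ring = fromCommutativeRing +-*-commutativeRing (λ x → dec⇒maybe (0ℚ ≟ x))

two four : ℚ
two  = + 2 / 1
four = + 4 / 1

0≤two : 0ℚ ≤ two
0≤two = *≤* (ℤ.+≤+ ℕ.z≤n)

0≤four : 0ℚ ≤ four
0≤four = *≤* (ℤ.+≤+ ℕ.z≤n)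

0<two : 0ℚ < two
0<two = *<* (ℤ.+<+ (ℕ.s≤s ℕ.z≤n))

≤-by : ∀ {a b} d → b ≡ a + d → 0ℚ ≤ d → a ≤ b
≤-by {a} d refl 0≤d = subst (_≤ a + d) (+-identityʳ a) (+-monoʳ-≤ a 0≤d)

0≤+ : ∀ {x y} → 0ℚ ≤ x → 0ℚ ≤ y → 0ℚ ≤ x + y
0≤+ = +-mono-≤

0≤* : ∀ {x y} → 0ℚ ≤ x → 0ℚ ≤ y → 0ℚ ≤ x * y
0≤* {x} {y} 0≤x 0≤y =
  nonNegative⁻¹ (x * y) {{nonNeg*nonNeg⇒nonNeg x {{nonNegative 0≤x}} y {{nonNegative 0≤y}}}}

0≤sq : ∀ x → 0ℚ ≤ x * x
0≤sq x with ≤-total 0ℚ x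
... | inj₁ 0≤x = 0≤* 0≤x 0≤x
... | inj₂ x≤0 = subst (0ℚ ≤_) (neg-square x) (0≤* (neg-antimono-≤ x≤0) (neg-antimono-≤ x≤0))
  where
  neg-square : ∀ x → - x * - x ≡ x * x
  neg-square = solve-∀ ℚ-ring

0≤-difference : ∀ {a b} → a ≤ b → 0ℚ ≤ b - a
0≤-difference {a} {b} a≤b = subst (_≤ b - a) (+-inverseʳ a) (+-monoˡ-≤ (- a) a≤b)

difference≤0 : ∀ {a b} → a ≤ b → a - b ≤ 0ℚ
difference≤0 {a} {b} a≤b = subst (a - b ≤_) (+-inverseʳ b) (+-monoˡ-≤ (- b) a≤b)

+-cancelˡ-≤ : ∀ a {x y} → a + x ≤ a + y → x ≤ y
+-cancelˡ-≤ a {x} {y} a+x≤a+y =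
  subst₂ _≤_ (-a+[a+z]≡z a x) (-a+[a+z]≡z a y) (+-monoʳ-≤ (- a) a+x≤a+y)
  where
  -a+[a+z]≡z : ∀ a z → - a + (a + z) ≡ z
  -a+[a+z]≡z = solve-∀ ℚ-ring

*-cancelˡ-≡-pos : ∀ r {p q} → 0ℚ < r → r * p ≡ r * q → p ≡ q
*-cancelˡ-≡-pos r 0<r rp≡rq = ≤-antisym (*-cancelˡ-≤-pos r {{positive 0<r}} (≤-reflexive rp≡rq))
                                        (*-cancelˡ-≤-pos r {{positive 0<r}} (≤-reflexive (sym rp≡rq)))

x≤x+y : ∀ x {y} → 0ℚ ≤ y → x ≤ x + y
x≤x+y x {y} 0≤y = ≤-by y refl 0≤y

x-y≤x : ∀ x {y} → 0ℚ ≤ y → x - y ≤ x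
x-y≤x x {y} 0≤y = ≤-by y (x≡x-y+y x y) 0≤y
  where
  x≡x-y+y : ∀ x y → x ≡ x - y + y
  x≡x-y+y = solve-∀ ℚ-ring

pos-nonneg : ∀ {x} → 0ℚ ≤ x → pos x ≡ x
pos-nonneg = p≥q⇒p⊔q≡p

pos-nonpos : ∀ {x} → x ≤ 0ℚ → pos x ≡ 0ℚ
pos-nonpos = p≤q⇒p⊔q≡q

infixr 8 _·_
_·_ : ℕ → ℚ → ℚ
zero  · x = 0ℚ
suc k · x = x + k · x

·-as-* : ∀ k x → k · x ≡ x * (k · 1ℚ)
·-as-* zero    x = sym (*-zeroʳ x)
·-as-* (suc k) x = begin
  x + k · x              ≡⟨ cong (λ y → x + y) (·-as-* k x) ⟩
  x + x * (k · 1ℚ)       ≡⟨ distribute x (k · 1ℚ) ⟩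
  x * (1ℚ + k · 1ℚ)      ∎
  where
  open ≡-Reasoning
  distribute : ∀ x y → x + x * y ≡ x * (1ℚ + y)
  distribute = solve-∀ ℚ-ring

·-zero : ∀ k → k · 0ℚ ≡ 0ℚ
·-zero zero    = refl
·-zero (suc k) = trans (+-identityˡ (k · 0ℚ)) (·-zero k)

·-nonneg : ∀ k {x} → 0ℚ ≤ x → 0ℚ ≤ k · x
·-nonneg zero    0≤x = ≤-refl
·-nonneg (suc k) 0≤x = 0≤+ 0≤x (·-nonneg k 0≤x)

archimedean : ∀ q → ∃[ k ] q < k · 1ℚ
archimedean (mkℚ ℤ.-[1+ a ] den c) = 1 , *<* ℤ.-<+
archimedean (mkℚ (+ a) den c) = suc a , subst (mkℚ (+ a) den c <_) (sym (·-one (suc a))) (*<* num<)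
  where
  ·-one : ∀ k → k · 1ℚ ≡ mkℚ (+ k) 0 (λ g → ∣1⇒≡1 (proj₂ g))
  ·-one zero    = refl
  ·-one (suc k) rewrite ·-one k =
    trans (cong (λ z → (+ 1 ℤ.+ z) / 1) (ℤP.*-identityʳ (+ k))) (↥p/↧p≡p _)
  num< : + a ℤ.* + 1 ℤ.< + (suc a ℕ.* suc den)
  num< = subst (ℤ._< + (suc a ℕ.* suc den)) (sym (ℤP.*-identityʳ (+ a)))
           (ℤ.+<+ (ℕP.<-≤-trans (ℕP.n<1+n a) (ℕP.m≤m*n (suc a) (suc den))))

archimedean-scaled : ∀ a γ → 0ℚ < a → ∃[ k ] γ < a * (k · 1ℚ)
archimedean-scaled a γ 0<a =
  let (k , γ/a<k) = archimedean (γ * 1/ a)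
  in k , subst (_< a * (k · 1ℚ)) a*γ/a≡γ (*-monoʳ-<-pos a {{positive 0<a}} γ/a<k)
  where
  instance _ = >-nonZero 0<a
  a*γ/a≡γ : a * (γ * 1/ a) ≡ γ
  a*γ/a≡γ = begin
    a * (γ * 1/ a)   ≡⟨ regroup a γ (1/ a) ⟩
    (a * 1/ a) * γ   ≡⟨ cong (_* γ) (*-inverseʳ a) ⟩
    1ℚ * γ           ≡⟨ *-identityˡ γ ⟩
    γ                ∎
    where
    open ≡-Reasoning
    regroup : ∀ a γ b → a * (γ * b) ≡ (a * b) * γ
    regroup = solve-∀ ℚ-ring

room-for-ε : ∀ {x ε} m → two * ε ≤ x → ε * (m · 1ℚ) ≤ (x - ε) * (m · 1ℚ)
room-for-ε {x} {ε} m 2ε≤x = *-monoʳ-≤-nonNeg (m · 1ℚ) {{nonNegative (·-nonneg m (<⇒≤ (positive⁻¹ 1ℚ)))}}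
  (≤-by {ε} (x - two * ε) (room x ε) (0≤-difference 2ε≤x))
  where
  room : ∀ x e → x - e ≡ e + (x - two * e)
  room = solve-∀ ℚ-ring

variable
  X Y : Set

expect : List (ℚ × X) → (X → ℚ) → ℚ
expect []            f = 0ℚ
expect ((p , a) ∷ d) f = p * f a + expect d f

mass : List (ℚ × X) → ℚ
mass d = expect d (λ _ → 1ℚ)

expect-cong : ∀ d {f f' : X → ℚ} → (∀ a → f a ≡ f' a) → expect d f ≡ expect d f'
expect-cong []            f≗f' = refl
expect-cong ((p , a) ∷ d) f≗f' = cong₂ (λ u v → p * u + v) (f≗f' a) (expect-cong d f≗f')

expect-++ : ∀ d e (f : X → ℚ) → expect (d ++ e) f ≡ expect d f + expect e f
expect-++ []            e f = sym (+-identityˡ _)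
expect-++ ((p , a) ∷ d) e f =
  trans (cong (λ z → p * f a + z) (expect-++ d e f)) (sym (+-assoc (p * f a) _ _))

expect-shift : ∀ d c (f : X → ℚ) → expect d (λ a → c + f a) ≡ c * mass d + expect d f
expect-shift []            c f = sym (trans (+-identityʳ (c * 0ℚ)) (*-zeroʳ c))
expect-shift ((p , a) ∷ d) c f = begin
  p * (c + f a) + expect d (λ a → c + f a)  ≡⟨ cong (λ z → p * (c + f a) + z) (expect-shift d c f) ⟩
  p * (c + f a) + (c * m + E)              ≡⟨ regroup p c (f a) m E ⟩
  c * (p * 1ℚ + m) + (p * f a + E)          ∎
  where
  open ≡-Reasoning
  m = mass d
  E = expect d f
  regroup : ∀ p c x m E → p * (c + x) + (c * m + E) ≡ c * (p * 1ℚ + m) + (p * x + E)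
  regroup = solve-∀ ℚ-ring

expect-scale : ∀ (h : ℚ × X → ℚ × Y) p (k : X → Y) → (∀ q a → h (q , a) ≡ (p * q , k a)) →
               ∀ d f → expect (map h d) f ≡ p * expect d (f ∘ k)
expect-scale h p k h-spec []            f = sym (*-zeroʳ p)
expect-scale h p k h-spec ((q , a) ∷ d) f rewrite h-spec q a =
  trans (cong₂ _+_ (*-assoc p q _) (expect-scale h p k h-spec d f)) (sym (*-distribˡ-+ p _ _))

-- Law of total expectation for a two-stage experiment: first draw a from d,
-- then an outcome from K (p , a), whose conditional expectation is F a.
expect-bind : ∀ (K : ℚ × X → List (ℚ × Y)) (f : Y → ℚ) (F : X → ℚ) →
              (∀ p a → expect (K (p , a)) f ≡ p * F a) →
              ∀ d → expect (concatMap K d) f ≡ expect d F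
expect-bind K f F K-spec []            = refl
expect-bind K f F K-spec ((p , a) ∷ d) =
  trans (expect-++ (K (p , a)) (concatMap K d) f) (cong₂ _+_ (K-spec p a) (expect-bind K f F K-spec d))

expect-as-foldr : ∀ d (f : X → ℚ) → foldr _+_ 0ℚ (map (λ { (p , a) → p * f a }) d) ≡ expect d f
expect-as-foldr []            f = refl
expect-as-foldr ((p , a) ∷ d) f = cong (λ z → p * f a + z) (expect-as-foldr d f)

/'-cancel : ∀ p q → ¬ q ≡ 0ℚ → (p /' q) * q ≡ p
/'-cancel p q q≢0 with q ≟ 0ℚ
... | yes q≡0 = ⊥-elim (q≢0 q≡0)
... | no  q≢0′ = begin
  p * 1/ q * q     ≡⟨ *-assoc p (1/ q) q ⟩
  p * (1/ q * q)   ≡⟨ cong (p *_) (*-inverseˡ q) ⟩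
  p * 1ℚ           ≡⟨ *-identityʳ p ⟩
  p                ∎
  where
  open ≡-Reasoning
  instance _ = ≢-nonZero q≢0′

foldr-⊓-preserves : ∀ (P : ℚ → Set) → (∀ {x y} → P x → P y → P (x ⊓ y)) →
                    ∀ {z L} → P z → All P L → P (foldr _⊓_ z L)
foldr-⊓-preserves P P-⊓ Pz []         = Pz
foldr-⊓-preserves P P-⊓ Pz (Py ∷ PL) = P-⊓ Py (foldr-⊓-preserves P P-⊓ Pz PL)

foldr-⊓≤init : ∀ z L → foldr _⊓_ z L ≤ z
foldr-⊓≤init z []      = ≤-refl
foldr-⊓≤init z (y ∷ L) = p≤q⇒r⊓p≤q y (foldr-⊓≤init z L)

module Chase (β H : ℚ) (0<β : 0ℚ < β) where
  open SP β H

  0≤β : 0ℚ ≤ β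
  0≤β = <⇒≤ 0<β

  Admissible : ℚ → Set
  Admissible Δ = (- β ≤ Δ) × (Δ ≤ 0ℚ)

  -β-admissible : Admissible (- β)
  -β-admissible = ≤-refl , neg-antimono-≤ 0≤β

  Δnext-admissible : ∀ Δ σ → Admissible (Δnext Δ σ)
  Δnext-admissible Δ σ = ⊓-glb (neg-antimono-≤ 0≤β) (p≤q⊔p (Δ + δ σ) (- β)) , p⊓q≤p 0ℚ ((Δ + δ σ) ⊔ (- β))

  Δnext-bottom : ∀ Δ σ → Δ + δ σ ≤ - β → Δnext Δ σ ≡ - β
  Δnext-bottom Δ σ low = trans (cong (0ℚ ⊓_) (p≤q⇒p⊔q≡q low)) (p≥q⇒p⊓q≡q (neg-antimono-≤ 0≤β))

  Δnext-interior : ∀ Δ σ → - β ≤ Δ + δ σ → Δ + δ σ ≤ 0ℚ → Δnext Δ σ ≡ Δ + δ σ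
  Δnext-interior Δ σ low high = trans (cong (0ℚ ⊓_) (p≥q⇒p⊔q≡p low)) (p≥q⇒p⊓q≡q high)

  Δnext-top : ∀ Δ σ → - β ≤ Δ + δ σ → 0ℚ ≤ Δ + δ σ → Δnext Δ σ ≡ 0ℚ
  Δnext-top Δ σ low high = trans (cong (0ℚ ⊓_) (p≥q⇒p⊔q≡p low)) (p≤q⇒p⊓q≡p high)

  0≤β+ : ∀ {Δ} → - β ≤ Δ → 0ℚ ≤ β + Δ
  0≤β+ {Δ} -β≤Δ = subst (_≤ β + Δ) (+-inverseʳ β) (+-monoʳ-≤ β -β≤Δ)

  step-mass : ∀ Δ Δ' s → mass (step Δ Δ' s) ≡ 1ℚ
  step-mass Δ Δ' s with Δ' ≟ 0ℚ
  ... | yes _ = refl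
  ... | no _ with Δ' ≟ (- β)
  ...   | yes _ = refl
  ...   | no _ with Δ ≤? Δ'
  ...     | yes _ with s
  ...       | true  = refl
  ...       | false = two-point (Δ' /' Δ)
    where
    two-point : ∀ r → r * 1ℚ + ((1ℚ - r) * 1ℚ + 0ℚ) ≡ 1ℚ
    two-point = solve-∀ ℚ-ring
  step-mass Δ Δ' s | no _ | no _ | no _ with s
  ...       | false = refl
  ...       | true  = two-point ((β + Δ') /' (β + Δ))
    where
    two-point : ∀ r → (1ℚ - r) * 1ℚ + (r * 1ℚ + 0ℚ) ≡ 1ℚ
    two-point = solve-∀ ℚ-ring

  expect-run : ∀ Δ s σ σs (f : List Bool → ℚ) →
    expect (run Δ s (σ ∷ σs)) f
      ≡ expect (step Δ (Δnext Δ σ) s) (λ s' → expect (run (Δnext Δ σ) s' σs) (λ ss → f (s' ∷ ss)))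
  expect-run Δ s σ σs f = expect-bind _ f _
    (λ p s' → expect-scale _ p (λ ss → s' ∷ ss) (λ q ss → refl) (run (Δnext Δ σ) s' σs) f)
    (step Δ (Δnext Δ σ) s)

  run-mass : ∀ Δ s σs → mass (run Δ s σs) ≡ 1ℚ
  run-mass Δ s []       = refl
  run-mass Δ s (σ ∷ σs) = begin
    mass (run Δ s (σ ∷ σs))                             ≡⟨ expect-run Δ s σ σs (λ _ → 1ℚ) ⟩
    expect (step Δ Δ' s) (λ s' → mass (run Δ' s' σs))   ≡⟨ expect-cong (step Δ Δ' s) (λ s' → run-mass Δ' s' σs) ⟩
    mass (step Δ Δ' s)                                  ≡⟨ step-mass Δ Δ' s ⟩
    1ℚ                                                  ∎
    where
    open ≡-Reasoning
    Δ' = Δnext Δ σ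

  EC : ℚ → Bool → List Input → ℚ
  EC Δ s σs = expect (run Δ s σs) (cost s σs)

  EC-cons : ∀ Δ s σ σs → EC Δ s (σ ∷ σs)
    ≡ expect (step Δ (Δnext Δ σ) s) (λ s' → g σ s' + switch s s' + EC (Δnext Δ σ) s' σs)
  EC-cons Δ s σ σs = trans (expect-run Δ s σ σs (cost s (σ ∷ σs)))
    (expect-cong (step Δ Δ' s) λ s' → begin
      expect (run Δ' s' σs) (λ ss → c s' + cost s' σs ss)  ≡⟨ expect-shift (run Δ' s' σs) (c s') (cost s' σs) ⟩
      c s' * mass (run Δ' s' σs) + EC Δ' s' σs              ≡⟨ cong (λ m → c s' * m + EC Δ' s' σs) (run-mass Δ' s' σs) ⟩
      c s' * 1ℚ + EC Δ' s' σs                               ≡⟨ cong (_+ EC Δ' s' σs) (*-identityʳ (c s')) ⟩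
      c s' + EC Δ' s' σs                                    ∎)
    where
    open ≡-Reasoning
    Δ' = Δnext Δ σ
    c : Bool → ℚ
    c s' = g σ s' + switch s s'

  ExpCost≡EC : ∀ σs → ExpCost σs ≡ EC (- β) false σs
  ExpCost≡EC σs = expect-as-foldr (run (- β) false σs) (cost false σs)

  -- β times the expected cost of the step that moves Δ(t-1) = Δ to Δ(t) = Δnext Δ σ: the
  -- state is 1 with probability (β + Δ(t))/β and switches on with probability (Δ(t) - Δ)^+/β.
  fracStep : ℚ → Input → ℚ
  fracStep Δ σ = (β + Δnext Δ σ) * g1 σ + (- Δnext Δ σ) * g0 σ + β * pos (Δnext Δ σ - Δ)

  -- β times the cost of the deterministic fractional algorithm x_t = 1 + Δ(t)/β.
  fracCost : ℚ → List Input → ℚ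
  fracCost Δ []       = 0ℚ
  fracCost Δ (σ ∷ σs) = fracStep Δ σ + fracCost (Δnext Δ σ) σs

  -- Each transports the weights
  -- (β + Δ) on state 1 and -Δ on state 0 to (β + Δ') and -Δ', moving mass (Δ' - Δ)^+
  -- from state 0 to state 1 (each such move pays β) and mass (Δ - Δ')^+ the other way.
  -- Here c₀, c₁ are the costs of the new states and E₀, E₁ the continuation values;
  -- the left-hand sides are the expectations over `step`'s lists exactly as they compute.

  transition-to-one : ∀ Δ Δ' P c₀ c₁ E₀ E₁ → Δ' ≡ 0ℚ → P ≡ 0ℚ - Δ →
    (β + Δ) * (1ℚ * (c₁ + 0ℚ + E₁) + 0ℚ) + (- Δ) * (1ℚ * (c₁ + β + E₁) + 0ℚ)
      ≡ (β + Δ') * (c₁ + E₁) + (- Δ') * (c₀ + E₀) + β * P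
  transition-to-one Δ .0ℚ .(0ℚ - Δ) c₀ c₁ E₀ E₁ refl refl =
    solve (List ℚ ∋ β ∷ Δ ∷ c₀ ∷ c₁ ∷ E₀ ∷ E₁ ∷ []) ℚ-ring

  transition-to-zero : ∀ Δ Δ' P c₀ c₁ E₀ E₁ → Δ' ≡ - β → P ≡ 0ℚ →
    (β + Δ) * (1ℚ * (c₀ + 0ℚ + E₀) + 0ℚ) + (- Δ) * (1ℚ * (c₀ + 0ℚ + E₀) + 0ℚ)
      ≡ (β + Δ') * (c₁ + E₁) + (- Δ') * (c₀ + E₀) + β * P
  transition-to-zero Δ .(- β) .0ℚ c₀ c₁ E₀ E₁ refl refl =
    solve (List ℚ ∋ β ∷ Δ ∷ c₀ ∷ c₁ ∷ E₀ ∷ E₁ ∷ []) ℚ-ring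

  -- Δ ≤ Δ' = r·Δ: state 1 stays, state 0 stays with probability r.
  transition-up : ∀ Δ Δ' r P c₀ c₁ E₀ E₁ → Δ' ≡ r * Δ → P ≡ Δ' - Δ →
    (β + Δ) * (1ℚ * (c₁ + 0ℚ + E₁) + 0ℚ)
      + (- Δ) * (r * (c₀ + 0ℚ + E₀) + ((1ℚ - r) * (c₁ + β + E₁) + 0ℚ))
      ≡ (β + Δ') * (c₁ + E₁) + (- Δ') * (c₀ + E₀) + β * P
  transition-up Δ .(r * Δ) r .(r * Δ - Δ) c₀ c₁ E₀ E₁ refl refl =
    solve (List ℚ ∋ β ∷ Δ ∷ r ∷ c₀ ∷ c₁ ∷ E₀ ∷ E₁ ∷ []) ℚ-ring

  -- Δ' < Δ, β + Δ' = q·(β + Δ): state 0 stays, state 1 stays with probability q.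
  transition-down : ∀ Δ Δ' q P c₀ c₁ E₀ E₁ → Δ' ≡ q * (β + Δ) - β → P ≡ 0ℚ →
    (β + Δ) * ((1ℚ - q) * (c₀ + 0ℚ + E₀) + (q * (c₁ + 0ℚ + E₁) + 0ℚ))
      + (- Δ) * (1ℚ * (c₀ + 0ℚ + E₀) + 0ℚ)
      ≡ (β + Δ') * (c₁ + E₁) + (- Δ') * (c₀ + E₀) + β * P
  transition-down Δ .(q * (β + Δ) - β) q .0ℚ c₀ c₁ E₀ E₁ refl refl =
    solve (List ℚ ∋ β ∷ Δ ∷ q ∷ c₀ ∷ c₁ ∷ E₀ ∷ E₁ ∷ []) ℚ-ring

  transition-identity : ∀ Δ Δ' (c E : Bool → ℚ) → Admissible Δ → Admissible Δ' →
    (β + Δ) * expect (step Δ Δ' true) (λ s' → c s' + switch true s' + E s')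
      + (- Δ) * expect (step Δ Δ' false) (λ s' → c s' + switch false s' + E s')
      ≡ (β + Δ') * (c true + E true) + (- Δ') * (c false + E false) + β * pos (Δ' - Δ)
  transition-identity Δ Δ' c E (-β≤Δ , Δ≤0) (-β≤Δ' , Δ'≤0) with Δ' ≟ 0ℚ
  ... | yes Δ'≡0 = transition-to-one Δ Δ' _ (c false) (c true) (E false) (E true) Δ'≡0
         (trans (cong (λ x → pos (x - Δ)) Δ'≡0) (pos-nonneg (0≤-difference Δ≤0)))
  ... | no Δ'≢0 with Δ' ≟ (- β)
  ...   | yes Δ'≡-β = transition-to-zero Δ Δ' _ (c false) (c true) (E false) (E true) Δ'≡-β
           (pos-nonpos (difference≤0 (subst (_≤ Δ) (sym Δ'≡-β) -β≤Δ)))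
  ...   | no _ with Δ ≤? Δ'
  ...     | yes Δ≤Δ' = transition-up Δ Δ' (Δ' /' Δ) _ (c false) (c true) (E false) (E true)
             (sym (/'-cancel Δ' Δ Δ≢0)) (pos-nonneg (0≤-difference Δ≤Δ'))
    where
    Δ≢0 : ¬ Δ ≡ 0ℚ
    Δ≢0 Δ≡0 = Δ'≢0 (≤-antisym Δ'≤0 (subst (_≤ Δ') Δ≡0 Δ≤Δ'))
  ...     | no Δ≰Δ' = transition-down Δ Δ' q _ (c false) (c true) (E false) (E true)
             Δ'≡ (pos-nonpos (difference≤0 (<⇒≤ Δ'<Δ)))
    where
    open ≡-Reasoning
    Δ'<Δ : Δ' < Δ
    Δ'<Δ = ≰⇒> Δ≰Δ'
    0<β+Δ : 0ℚ < β + Δ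
    0<β+Δ = ≤-<-trans (0≤β+ -β≤Δ') (+-monoʳ-< β Δ'<Δ)
    q = (β + Δ') /' (β + Δ)
    Δ'≡ : Δ' ≡ q * (β + Δ) - β
    Δ'≡ = sym (begin
      q * (β + Δ) - β  ≡⟨ cong (_- β) (/'-cancel (β + Δ') (β + Δ) (λ e → <-irrefl (sym e) 0<β+Δ)) ⟩
      β + Δ' - β       ≡⟨ solve (List ℚ ∋ β ∷ Δ' ∷ []) ℚ-ring ⟩
      Δ'               ∎)

  closed-form : ∀ σs Δ → Admissible Δ →
    (β + Δ) * EC Δ true σs + (- Δ) * EC Δ false σs ≡ fracCost Δ σs
  closed-form []       Δ _   = solve (List ℚ ∋ β ∷ Δ ∷ []) ℚ-ring
  closed-form (σ ∷ σs) Δ adm = begin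
    (β + Δ) * EC Δ true (σ ∷ σs) + (- Δ) * EC Δ false (σ ∷ σs)
      ≡⟨ cong₂ (λ x y → (β + Δ) * x + (- Δ) * y) (EC-cons Δ true σ σs) (EC-cons Δ false σ σs) ⟩
    (β + Δ) * expect (step Δ Δ' true) (λ s' → g σ s' + switch true s' + E s')
      + (- Δ) * expect (step Δ Δ' false) (λ s' → g σ s' + switch false s' + E s')
      ≡⟨ transition-identity Δ Δ' (g σ) E adm adm' ⟩
    (β + Δ') * (g1 σ + E true) + (- Δ') * (g0 σ + E false) + β * pos (Δ' - Δ)
      ≡⟨ separate β Δ' (g0 σ) (g1 σ) (pos (Δ' - Δ)) (E false) (E true) ⟩
    fracStep Δ σ + ((β + Δ') * E true + (- Δ') * E false)
      ≡⟨ cong (λ z → fracStep Δ σ + z) (closed-form σs Δ' adm') ⟩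
    fracCost Δ (σ ∷ σs) ∎
    where
    open ≡-Reasoning
    Δ' = Δnext Δ σ
    adm' = Δnext-admissible Δ σ
    E : Bool → ℚ
    E s' = EC Δ' s' σs
    separate : ∀ b d a c P E₀ E₁ → (b + d) * (c + E₁) + (- d) * (a + E₀) + b * P
      ≡ ((b + d) * c + (- d) * a + b * P) + ((b + d) * E₁ + (- d) * E₀)
    separate = solve-∀ ℚ-ring

  βExpCost : ∀ σs → β * ExpCost σs ≡ fracCost (- β) σs
  βExpCost σs = begin
    β * ExpCost σs                                       ≡⟨ cong (β *_) (ExpCost≡EC σs) ⟩
    β * EC (- β) false σs                                ≡⟨ only-zero β (EC (- β) true σs) (EC (- β) false σs) ⟩
    (β + - β) * EC (- β) true σs + (- - β) * EC (- β) false σs  ≡⟨ closed-form σs (- β) -β-admissible ⟩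
    fracCost (- β) σs                                    ∎
    where
    open ≡-Reasoning
    only-zero : ∀ b x y → b * y ≡ (b + - b) * x + (- - b) * y
    only-zero = solve-∀ ℚ-ring

  0<2β : 0ℚ < two * β
  0<2β = positive⁻¹ (two * β) {{pos*pos⇒pos two β {{positive 0<β}}}}

  0≤2β : 0ℚ ≤ two * β
  0≤2β = 0≤* 0≤two 0≤β

  0≤4β : 0ℚ ≤ four * β
  0≤4β = 0≤* 0≤four 0≤β

  Ψ : Bool → ℚ → ℚ
  Ψ false Δ = (β + Δ) * (β + Δ)
  Ψ true  Δ = (β - Δ) * (β - Δ)

  Ψ-nonneg : ∀ s Δ → 0ℚ ≤ Ψ s Δ
  Ψ-nonneg false Δ = 0≤sq (β + Δ)
  Ψ-nonneg true  Δ = 0≤sq (β - Δ)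

  no-switch : ∀ x → x ≤ four * β * 0ℚ + x
  no-switch x = ≤-reflexive (sym (trans (cong (_+ x) (*-zeroʳ (four * β))) (+-identityˡ x)))

  potential-switch : ∀ s s' Δ → Admissible Δ → Ψ s' Δ ≤ four * β * switch s s' + Ψ s Δ
  potential-switch false false Δ _           = no-switch (Ψ false Δ)
  potential-switch true  true  Δ _           = no-switch (Ψ true Δ)
  potential-switch false true  Δ (-β≤Δ , _) =
    ≤-by (four * β * (β + Δ)) (switch-on β Δ) (0≤* 0≤4β (0≤β+ -β≤Δ))
    where
    switch-on : ∀ b x → four * b * b + (b + x) * (b + x) ≡ (b - x) * (b - x) + four * b * (b + x)
    switch-on = solve-∀ ℚ-ring
  potential-switch true  false Δ (_ , Δ≤0)  =
    ≤-by (four * β * (- Δ)) (switch-off β Δ) (0≤* 0≤4β (neg-antimono-≤ Δ≤0))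
    where
    switch-off : ∀ b x → four * b * 0ℚ + (b - x) * (b - x) ≡ (b + x) * (b + x) + four * b * (- x)
    switch-off = solve-∀ ℚ-ring

  -- The one-step potential inequality 2·fracStep + Ψ(s', Δ') ≤ 4β·g(s') + Ψ(s', Δ),
  -- written out for the costs a = g(0), c = g(1) and the up-move P = (Δ' - Δ)^+.
  StepBound : (Δ Δ' a c P : ℚ) → Bool → Set
  StepBound Δ Δ' a c P false =
    two * ((β + Δ') * c + (- Δ') * a + β * P) + (β + Δ') * (β + Δ') ≤ four * β * a + (β + Δ) * (β + Δ)
  StepBound Δ Δ' a c P true  =
    two * ((β + Δ') * c + (- Δ') * a + β * P) + (β - Δ') * (β - Δ') ≤ four * β * c + (β - Δ) * (β - Δ)

  bound-interior-up : ∀ Δ Δ' a c P → Δ' ≡ Δ + (a - c) → P ≡ Δ' - Δ → 0ℚ ≤ c → ∀ s' → StepBound Δ Δ' a c P s'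
  bound-interior-up Δ .(Δ + (a - c)) a c .(Δ + (a - c) - Δ) refl refl 0≤c false =
    ≤-by (two * β * c + (a - c) * (a - c)) (solve (List ℚ ∋ β ∷ Δ ∷ a ∷ c ∷ []) ℚ-ring)
         (0≤+ (0≤* 0≤2β 0≤c) (0≤sq (a - c)))
  bound-interior-up Δ .(Δ + (a - c)) a c .(Δ + (a - c) - Δ) refl refl 0≤c true  =
    ≤-by (two * β * c + (a - c) * (a - c)) (solve (List ℚ ∋ β ∷ Δ ∷ a ∷ c ∷ []) ℚ-ring)
         (0≤+ (0≤* 0≤2β 0≤c) (0≤sq (a - c)))

  bound-interior-down : ∀ Δ Δ' a c P → Δ' ≡ Δ + (a - c) → P ≡ 0ℚ → 0ℚ ≤ a → ∀ s' → StepBound Δ Δ' a c P s'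
  bound-interior-down Δ .(Δ + (a - c)) a c .0ℚ refl refl 0≤a false =
    ≤-by (two * β * a + (a - c) * (a - c)) (solve (List ℚ ∋ β ∷ Δ ∷ a ∷ c ∷ []) ℚ-ring)
         (0≤+ (0≤* 0≤2β 0≤a) (0≤sq (a - c)))
  bound-interior-down Δ .(Δ + (a - c)) a c .0ℚ refl refl 0≤a true  =
    ≤-by (two * β * a + (a - c) * (a - c)) (solve (List ℚ ∋ β ∷ Δ ∷ a ∷ c ∷ []) ℚ-ring)
         (0≤+ (0≤* 0≤2β 0≤a) (0≤sq (a - c)))

  bound-clipped-top : ∀ Δ Δ' a c P → 0ℚ ≤ Δ + (a - c) → Δ' ≡ 0ℚ → P ≡ 0ℚ - Δ → 0ℚ ≤ c →
                      ∀ s' → StepBound Δ Δ' a c P s'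
  bound-clipped-top Δ .0ℚ a c .(0ℚ - Δ) 0≤u refl refl 0≤c false =
    ≤-by (two * β * c + four * β * (Δ + (a - c)) + Δ * Δ) (solve (List ℚ ∋ β ∷ Δ ∷ a ∷ c ∷ []) ℚ-ring)
         (0≤+ (0≤+ (0≤* 0≤2β 0≤c) (0≤* 0≤4β 0≤u)) (0≤sq Δ))
  bound-clipped-top Δ .0ℚ a c .(0ℚ - Δ) 0≤u refl refl 0≤c true  =
    ≤-by (two * β * c + Δ * Δ) (solve (List ℚ ∋ β ∷ Δ ∷ a ∷ c ∷ []) ℚ-ring)
         (0≤+ (0≤* 0≤2β 0≤c) (0≤sq Δ))

  bound-clipped-bottom : ∀ Δ Δ' a c P → 0ℚ ≤ - β - (Δ + (a - c)) → Δ' ≡ - β → P ≡ 0ℚ → 0ℚ ≤ a →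
                         ∀ s' → StepBound Δ Δ' a c P s'
  bound-clipped-bottom Δ .(- β) a c .0ℚ 0≤v refl refl 0≤a false =
    ≤-by (two * β * a + (β + Δ) * (β + Δ)) (solve (List ℚ ∋ β ∷ Δ ∷ a ∷ c ∷ []) ℚ-ring)
         (0≤+ (0≤* 0≤2β 0≤a) (0≤sq (β + Δ)))
  bound-clipped-bottom Δ .(- β) a c .0ℚ 0≤v refl refl 0≤a true  =
    ≤-by (two * β * a + four * β * (- β - (Δ + (a - c))) + (β + Δ) * (β + Δ))
         (solve (List ℚ ∋ β ∷ Δ ∷ a ∷ c ∷ []) ℚ-ring)
         (0≤+ (0≤+ (0≤* 0≤2β 0≤a) (0≤* 0≤4β 0≤v)) (0≤sq (β + Δ)))

  step-bound : ∀ Δ σ → Nonneg σ → Admissible Δ →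
               ∀ s' → StepBound Δ (Δnext Δ σ) (g0 σ) (g1 σ) (pos (Δnext Δ σ - Δ)) s'
  step-bound Δ σ (0≤a , 0≤c) (-β≤Δ , Δ≤0) with (Δ + δ σ) ≤? (- β)
  ... | yes low = bound-clipped-bottom Δ _ (g0 σ) (g1 σ) _ (0≤-difference low) Δ'≡-β
                    (pos-nonpos (difference≤0 (subst (_≤ Δ) (sym Δ'≡-β) -β≤Δ))) 0≤a
    where
    Δ'≡-β = Δnext-bottom Δ σ low
  ... | no not-low with (Δ + δ σ) ≤? 0ℚ
  ...   | yes high = interior (≤-total 0ℚ (Δnext Δ σ - Δ))
    where
    Δ'≡ = Δnext-interior Δ σ (<⇒≤ (≰⇒> not-low)) high
    interior : (0ℚ ≤ Δnext Δ σ - Δ) ⊎ (Δnext Δ σ - Δ ≤ 0ℚ) →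
               ∀ s' → StepBound Δ (Δnext Δ σ) (g0 σ) (g1 σ) (pos (Δnext Δ σ - Δ)) s'
    interior (inj₁ up)   = bound-interior-up Δ _ (g0 σ) (g1 σ) _ Δ'≡ (pos-nonneg up) 0≤c
    interior (inj₂ down) = bound-interior-down Δ _ (g0 σ) (g1 σ) _ Δ'≡ (pos-nonpos down) 0≤a
  step-bound Δ σ (0≤a , 0≤c) (-β≤Δ , Δ≤0) | no not-low | no not-high =
    bound-clipped-top Δ _ (g0 σ) (g1 σ) _ (<⇒≤ (≰⇒> not-high)) Δ'≡0
      (trans (cong (λ x → pos (x - Δ)) Δ'≡0) (pos-nonneg (0≤-difference Δ≤0))) 0≤c
    where
    Δ'≡0 = Δnext-top Δ σ (<⇒≤ (≰⇒> not-low)) (<⇒≤ (≰⇒> not-high))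

  potential-step : ∀ Δ σ s' → Nonneg σ → Admissible Δ →
                   two * fracStep Δ σ + Ψ s' (Δnext Δ σ) ≤ four * β * g σ s' + Ψ s' Δ
  potential-step Δ σ false nn adm = step-bound Δ σ nn adm false
  potential-step Δ σ true  nn adm = step-bound Δ σ nn adm true

  fracCost-bound : ∀ σs ss → length ss ≡ length σs → All Nonneg σs → ∀ Δ s → Admissible Δ →
                   two * fracCost Δ σs ≤ four * β * cost s σs ss + Ψ s Δ
  fracCost-bound []       []        _   _          Δ s adm = ≤-trans (Ψ-nonneg s Δ) (no-switch (Ψ s Δ))
  fracCost-bound []       (_ ∷ _)   ()  _          _ _ _
  fracCost-bound (_ ∷ _)  []        ()  _          _ _ _
  fracCost-bound (σ ∷ σs) (s' ∷ ss) len (nn ∷ nns) Δ s adm = begin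
    two * (fracStep Δ σ + fracCost Δ' σs)
      ≡⟨ *-distribˡ-+ two (fracStep Δ σ) (fracCost Δ' σs) ⟩
    two * fracStep Δ σ + two * fracCost Δ' σs
      ≤⟨ +-monoʳ-≤ (two * fracStep Δ σ) (fracCost-bound σs ss (ℕP.suc-injective len) nns Δ' s' adm') ⟩
    two * fracStep Δ σ + (four * β * rest + Ψ s' Δ')
      ≡⟨ swap (two * fracStep Δ σ) (four * β * rest) (Ψ s' Δ') ⟩
    (two * fracStep Δ σ + Ψ s' Δ') + four * β * rest
      ≤⟨ +-monoˡ-≤ (four * β * rest) (potential-step Δ σ s' nn adm) ⟩
    (four * β * g σ s' + Ψ s' Δ) + four * β * rest
      ≤⟨ +-monoˡ-≤ (four * β * rest) (+-monoʳ-≤ (four * β * g σ s') (potential-switch s s' Δ adm)) ⟩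
    (four * β * g σ s' + (four * β * switch s s' + Ψ s Δ)) + four * β * rest
      ≡⟨ collect (four * β) (g σ s') (switch s s') rest (Ψ s Δ) ⟩
    four * β * (g σ s' + switch s s' + rest) + Ψ s Δ ∎
    where
    open ≤-Reasoning
    Δ' = Δnext Δ σ
    adm' = Δnext-admissible Δ σ
    rest = cost s' σs ss
    swap : ∀ x y z → x + (y + z) ≡ (x + z) + y
    swap = solve-∀ ℚ-ring
    collect : ∀ k x y c p → (k * x + (k * y + p)) + k * c ≡ k * (x + y + c) + p
    collect = solve-∀ ℚ-ring

  ExpCost≤2cost : ∀ σs ss → length ss ≡ length σs → All Nonneg σs → ExpCost σs ≤ two * cost false σs ss
  ExpCost≤2cost σs ss len nn = *-cancelˡ-≤-pos (two * β) {{positive 0<2β}} (begin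
    two * β * ExpCost σs          ≡⟨ *-assoc two β (ExpCost σs) ⟩
    two * (β * ExpCost σs)        ≡⟨ cong (two *_) (βExpCost σs) ⟩
    two * fracCost (- β) σs       ≤⟨ fracCost-bound σs ss len nn (- β) false -β-admissible ⟩
    four * β * cost false σs ss + Ψ false (- β)  ≡⟨ initial-potential β (cost false σs ss) ⟩
    two * β * (two * cost false σs ss) ∎)
    where
    open ≤-Reasoning
    initial-potential : ∀ b c → four * b * c + (b + - b) * (b + - b) ≡ two * b * (two * c)
    initial-potential = solve-∀ ℚ-ring

  schedules-length : ∀ n → All (λ ss → length ss ≡ n) (schedules n)
  schedules-length zero    = refl ∷ []
  schedules-length (suc n) = ++⁺ (map⁺ (All.map (cong suc) (schedules-length n)))
                                 (map⁺ (All.map (cong suc) (schedules-length n)))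

  Opt-property : ∀ σs (P : ℚ → Set) → (∀ {x y} → P x → P y → P (x ⊓ y)) →
                  (∀ ss → length ss ≡ length σs → P (cost false σs ss)) → P (Opt σs)
  Opt-property σs P P-⊓ P-cost = foldr-⊓-preserves P P-⊓
    (P-cost _ (length-replicate (length σs)))
    (map⁺ (All.map (λ {ss} → P-cost ss) (schedules-length (length σs))))

  ExpCost≤2Opt : ∀ σs → All Nonneg σs → ExpCost σs ≤ two * Opt σs
  ExpCost≤2Opt σs nn = Opt-property σs (λ x → ExpCost σs ≤ two * x) (λ {x} {y} → twice-⊓ {x} {y})
                                    (λ ss len → ExpCost≤2cost σs ss len nn)
    where
    twice-⊓ : ∀ {x y} → ExpCost σs ≤ two * x → ExpCost σs ≤ two * y → ExpCost σs ≤ two * (x ⊓ y)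
    twice-⊓ {x} {y} ≤2x ≤2y =
      subst (ExpCost σs ≤_) (sym (*-distribˡ-⊓-nonNeg two {{nonNegative 0≤two}} x y)) (⊓-glb ≤2x ≤2y)

  upper : Competitive two
  upper = 0ℚ , λ σs nn → subst (ExpCost σs ≤_) (sym (+-identityʳ _)) (ExpCost≤2Opt σs nn)

  inp : ℚ → ℚ → Input
  inp a c = input 1ℚ a c 1ℚ

  g0-inp : ∀ a c → g0 (inp a c) ≡ a
  g0-inp a c = unfolded
    where
    unfolded : 1ℚ * a + (c - a) * 0ℚ - H * 0ℚ ≡ a
    unfolded = solve (List ℚ ∋ a ∷ c ∷ H ∷ []) ℚ-ring

  g1-inp : ∀ a c → g1 (inp a c) ≡ c
  g1-inp a c = *-identityˡ c

  δ-inp : ∀ a c → δ (inp a c) ≡ a - c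
  δ-inp a c = cong₂ _-_ (g0-inp a c) (g1-inp a c)

  inp-nonneg : ∀ {a c} → 0ℚ ≤ a → 0ℚ ≤ c → Nonneg (inp a c)
  inp-nonneg {a} {c} 0≤a 0≤c = subst (0ℚ ≤_) (sym (g0-inp a c)) 0≤a , subst (0ℚ ≤_) (sym (g1-inp a c)) 0≤c

  idle : List Input → ℚ
  idle []       = 0ℚ
  idle (σ ∷ σs) = g0 σ + idle σs

  idle-cost : ∀ σs → cost false σs (replicate (length σs) false) ≡ idle σs
  idle-cost []       = refl
  idle-cost (σ ∷ σs) = cong₂ _+_ (+-identityʳ (g0 σ)) (idle-cost σs)

  idle-++ : ∀ σs τs → idle (σs ++ τs) ≡ idle σs + idle τs
  idle-++ []       τs = sym (+-identityˡ (idle τs))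
  idle-++ (σ ∷ σs) τs = trans (cong (λ z → g0 σ + z) (idle-++ σs τs)) (sym (+-assoc (g0 σ) (idle σs) (idle τs)))

  idle-replicate : ∀ j a c → idle (replicate j (inp a c)) ≡ j · a
  idle-replicate zero    a c = refl
  idle-replicate (suc j) a c = cong₂ _+_ (g0-inp a c) (idle-replicate j a c)

  Opt≤idle : ∀ σs → Opt σs ≤ idle σs
  Opt≤idle σs = subst (Opt σs ≤_) (idle-cost σs) (foldr-⊓≤init _ (map (cost false σs) (schedules (length σs))))

  cost-nonneg : ∀ s σs ss → All Nonneg σs → 0ℚ ≤ cost s σs ss
  cost-nonneg s []       ss        _                  = ≤-refl
  cost-nonneg s (σ ∷ σs) []        _                  = ≤-refl
  cost-nonneg s (σ ∷ σs) (s' ∷ ss) ((0≤a , 0≤c) ∷ nn) =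
    0≤+ (0≤+ (g-nonneg s') (switch-nonneg s s')) (cost-nonneg s' σs ss nn)
    where
    g-nonneg : ∀ s' → 0ℚ ≤ g σ s'
    g-nonneg false = 0≤a
    g-nonneg true  = 0≤c
    switch-nonneg : ∀ s s' → 0ℚ ≤ switch s s'
    switch-nonneg false true  = 0≤β
    switch-nonneg false false = ≤-refl
    switch-nonneg true  _     = ≤-refl

  Opt-nonneg : ∀ σs → All Nonneg σs → 0ℚ ≤ Opt σs
  Opt-nonneg σs nn = Opt-property σs (0ℚ ≤_) ⊓-glb (λ ss _ → cost-nonneg false σs ss nn)

  module Zigzag (ε : ℚ) (0<ε : 0ℚ < ε) (n : ℕ) (nε≡β : n · ε ≡ β) where

    0≤ε : 0ℚ ≤ ε
    0≤ε = <⇒≤ 0<ε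

    rise fall : Input
    rise = inp ε 0ℚ
    fall = inp 0ℚ ε

    -- m rounds, each moving Δ from -β up to 0 in n rises and back down in n falls.
    zigzag : ℕ → List Input
    zigzag zero    = []
    zigzag (suc m) = replicate n rise ++ (replicate n fall ++ zigzag m)

    zigzag-nonneg : ∀ m → All Nonneg (zigzag m)
    zigzag-nonneg zero    = []
    zigzag-nonneg (suc m) = ++⁺ (replicate⁺ n (inp-nonneg 0≤ε ≤-refl))
                                (++⁺ (replicate⁺ n (inp-nonneg ≤-refl 0≤ε)) (zigzag-nonneg m))

    -- Twice the fractional cost of any rise or fall inside [-β, 0] is this constant
    -- plus the telescoping term Δ² - Δ'².
    L : ℚ
    L = two * β * ε - ε * ε

    rise-identity : ∀ Δ Δ' a c P → Δ' ≡ Δ + ε → a ≡ ε → c ≡ 0ℚ → P ≡ Δ' - Δ →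
      two * ((β + Δ') * c + (- Δ') * a + β * P) ≡ two * β * ε - ε * ε + (Δ * Δ - Δ' * Δ')
    rise-identity Δ .(Δ + ε) .ε .0ℚ .(Δ + ε - Δ) refl refl refl refl =
      solve (List ℚ ∋ β ∷ ε ∷ Δ ∷ []) ℚ-ring

    fall-identity : ∀ Δ Δ' a c P → Δ' ≡ Δ - ε → a ≡ 0ℚ → c ≡ ε → P ≡ 0ℚ →
      two * ((β + Δ') * c + (- Δ') * a + β * P) ≡ two * β * ε - ε * ε + (Δ * Δ - Δ' * Δ')
    fall-identity Δ .(Δ - ε) .0ℚ .ε .0ℚ refl refl refl refl =
      solve (List ℚ ∋ β ∷ ε ∷ Δ ∷ []) ℚ-ring

    rise-step : ∀ Δ → - β ≤ Δ → Δ + ε ≤ 0ℚ →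
      Δnext Δ rise ≡ Δ + ε × two * fracStep Δ rise ≡ L + (Δ * Δ - (Δ + ε) * (Δ + ε))
    rise-step Δ -β≤Δ Δ+ε≤0 = Δ'≡ ,
      trans (rise-identity Δ _ _ _ _ Δ'≡ (g0-inp ε 0ℚ) (g1-inp ε 0ℚ) (pos-nonneg 0≤Δ'-Δ))
            (cong (λ x → L + (Δ * Δ - x * x)) Δ'≡)
      where
      δ≡ : Δ + δ rise ≡ Δ + ε
      δ≡ = cong (λ x → Δ + x) (trans (δ-inp ε 0ℚ) (+-identityʳ ε))
      Δ'≡ : Δnext Δ rise ≡ Δ + ε
      Δ'≡ = trans (Δnext-interior Δ rise (subst (- β ≤_) (sym δ≡) (≤-trans -β≤Δ (x≤x+y Δ 0≤ε)))
                                         (subst (_≤ 0ℚ) (sym δ≡) Δ+ε≤0)) δ≡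
      0≤Δ'-Δ : 0ℚ ≤ Δnext Δ rise - Δ
      0≤Δ'-Δ = subst (λ x → 0ℚ ≤ x - Δ) (sym Δ'≡) (0≤-difference (x≤x+y Δ 0≤ε))

    fall-step : ∀ Δ → - β ≤ Δ - ε → Δ ≤ 0ℚ →
      Δnext Δ fall ≡ Δ - ε × two * fracStep Δ fall ≡ L + (Δ * Δ - (Δ - ε) * (Δ - ε))
    fall-step Δ -β≤Δ-ε Δ≤0 = Δ'≡ ,
      trans (fall-identity Δ _ _ _ _ Δ'≡ (g0-inp 0ℚ ε) (g1-inp 0ℚ ε) (pos-nonpos Δ'-Δ≤0))
            (cong (λ x → L + (Δ * Δ - x * x)) Δ'≡)
      where
      δ≡ : Δ + δ fall ≡ Δ - ε
      δ≡ = cong (λ x → Δ + x) (trans (δ-inp 0ℚ ε) (+-identityˡ (- ε)))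
      Δ'≡ : Δnext Δ fall ≡ Δ - ε
      Δ'≡ = trans (Δnext-interior Δ fall (subst (- β ≤_) (sym δ≡) -β≤Δ-ε)
                                         (subst (_≤ 0ℚ) (sym δ≡) (≤-trans (x-y≤x Δ 0≤ε) Δ≤0))) δ≡
      Δ'-Δ≤0 : Δnext Δ fall - Δ ≤ 0ℚ
      Δ'-Δ≤0 = subst (λ x → x - Δ ≤ 0ℚ) (sym Δ'≡) (difference≤0 (x-y≤x Δ 0≤ε))

    no-steps : ∀ x d → x ≡ 0ℚ + (d * d - d * d) + x
    no-steps = solve-∀ ℚ-ring

    one-more-step : ∀ l lj x d d₁ dₑ → l + (d * d - d₁ * d₁) + (lj + (d₁ * d₁ - dₑ * dₑ) + x)
                                      ≡ (l + lj) + (d * d - dₑ * dₑ) + x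
    one-more-step = solve-∀ ℚ-ring

    rise-phase : ∀ j Δ Δₑ rest → Δₑ ≡ Δ + j · ε → - β ≤ Δ → Δₑ ≤ 0ℚ →
      two * fracCost Δ (replicate j rise ++ rest) ≡ j · L + (Δ * Δ - Δₑ * Δₑ) + two * fracCost Δₑ rest
    rise-phase zero    Δ .(Δ + 0ℚ) rest refl _ _ rewrite +-identityʳ Δ = no-steps (two * fracCost Δ rest) Δ
    rise-phase (suc j) Δ Δₑ rest Δₑ≡ -β≤Δ Δₑ≤0 = begin
      two * (fracStep Δ rise + fracCost (Δnext Δ rise) (replicate j rise ++ rest))
        ≡⟨ *-distribˡ-+ two (fracStep Δ rise) (fracCost (Δnext Δ rise) (replicate j rise ++ rest)) ⟩
      two * fracStep Δ rise + two * fracCost (Δnext Δ rise) (replicate j rise ++ rest)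
        ≡⟨ cong₂ _+_ (proj₂ first) (cong (λ x → two * fracCost x (replicate j rise ++ rest)) (proj₁ first)) ⟩
      L + (Δ * Δ - Δ₁ * Δ₁) + two * fracCost Δ₁ (replicate j rise ++ rest)
        ≡⟨ cong (λ z → L + (Δ * Δ - Δ₁ * Δ₁) + z)
                (rise-phase j Δ₁ Δₑ rest Δₑ≡Δ₁+jε (≤-trans -β≤Δ (x≤x+y Δ 0≤ε)) Δₑ≤0) ⟩
      L + (Δ * Δ - Δ₁ * Δ₁) + (j · L + (Δ₁ * Δ₁ - Δₑ * Δₑ) + two * fracCost Δₑ rest)
        ≡⟨ one-more-step L (j · L) (two * fracCost Δₑ rest) Δ Δ₁ Δₑ ⟩
      suc j · L + (Δ * Δ - Δₑ * Δₑ) + two * fracCost Δₑ rest ∎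
      where
      open ≡-Reasoning
      Δ₁ = Δ + ε
      Δₑ≡Δ₁+jε : Δₑ ≡ Δ₁ + j · ε
      Δₑ≡Δ₁+jε = trans Δₑ≡ (sym (+-assoc Δ ε (j · ε)))
      first = rise-step Δ -β≤Δ (≤-trans (x≤x+y Δ₁ (·-nonneg j 0≤ε)) (subst (_≤ 0ℚ) Δₑ≡Δ₁+jε Δₑ≤0))

    fall-phase : ∀ j Δ Δₑ rest → Δₑ ≡ Δ - j · ε → - β ≤ Δₑ → Δ ≤ 0ℚ →
      two * fracCost Δ (replicate j fall ++ rest) ≡ j · L + (Δ * Δ - Δₑ * Δₑ) + two * fracCost Δₑ rest
    fall-phase zero    Δ .(Δ - 0ℚ) rest refl _ _ rewrite +-identityʳ Δ = no-steps (two * fracCost Δ rest) Δ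
    fall-phase (suc j) Δ Δₑ rest Δₑ≡ -β≤Δₑ Δ≤0 = begin
      two * (fracStep Δ fall + fracCost (Δnext Δ fall) (replicate j fall ++ rest))
        ≡⟨ *-distribˡ-+ two (fracStep Δ fall) (fracCost (Δnext Δ fall) (replicate j fall ++ rest)) ⟩
      two * fracStep Δ fall + two * fracCost (Δnext Δ fall) (replicate j fall ++ rest)
        ≡⟨ cong₂ _+_ (proj₂ first) (cong (λ x → two * fracCost x (replicate j fall ++ rest)) (proj₁ first)) ⟩
      L + (Δ * Δ - Δ₁ * Δ₁) + two * fracCost Δ₁ (replicate j fall ++ rest)
        ≡⟨ cong (λ z → L + (Δ * Δ - Δ₁ * Δ₁) + z)
                (fall-phase j Δ₁ Δₑ rest Δₑ≡Δ₁-jε -β≤Δₑ (≤-trans (x-y≤x Δ 0≤ε) Δ≤0)) ⟩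
      L + (Δ * Δ - Δ₁ * Δ₁) + (j · L + (Δ₁ * Δ₁ - Δₑ * Δₑ) + two * fracCost Δₑ rest)
        ≡⟨ one-more-step L (j · L) (two * fracCost Δₑ rest) Δ Δ₁ Δₑ ⟩
      suc j · L + (Δ * Δ - Δₑ * Δₑ) + two * fracCost Δₑ rest ∎
      where
      open ≡-Reasoning
      Δ₁ = Δ - ε
      Δₑ≡Δ₁-jε : Δₑ ≡ Δ₁ - j · ε
      Δₑ≡Δ₁-jε = trans Δₑ≡ (sub-sum Δ ε (j · ε))
        where
        sub-sum : ∀ d e m → d - (e + m) ≡ d - e - m
        sub-sum = solve-∀ ℚ-ring
      first = fall-step Δ (≤-trans -β≤Δₑ (subst (_≤ Δ₁) (sym Δₑ≡Δ₁-jε) (x-y≤x Δ₁ (·-nonneg j 0≤ε)))) Δ≤0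

    nL≡ : n · L ≡ β * (two * β - ε)
    nL≡ = begin
      n · L                          ≡⟨ ·-as-* n L ⟩
      L * (n · 1ℚ)                   ≡⟨ factor β ε (n · 1ℚ) ⟩
      (two * β - ε) * (ε * (n · 1ℚ)) ≡⟨ cong ((two * β - ε) *_) (trans (sym (·-as-* n ε)) nε≡β) ⟩
      (two * β - ε) * β              ≡⟨ *-comm (two * β - ε) β ⟩
      β * (two * β - ε)              ∎
      where
      open ≡-Reasoning
      factor : ∀ b e N → (two * b * e - e * e) * N ≡ (two * b - e) * (e * N)
      factor = solve-∀ ℚ-ring

    -- One round returns Δ to -β, so the telescoping terms cancel.
    round-cost : ∀ m → two * fracCost (- β) (zigzag (suc m)) ≡ two * (n · L) + two * fracCost (- β) (zigzag m)
    round-cost m = begin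
      two * fracCost (- β) (zigzag (suc m))
        ≡⟨ rise-phase n (- β) 0ℚ _ top ≤-refl ≤-refl ⟩
      n · L + ((- β) * (- β) - 0ℚ * 0ℚ) + two * fracCost 0ℚ (replicate n fall ++ zigzag m)
        ≡⟨ cong (λ z → n · L + ((- β) * (- β) - 0ℚ * 0ℚ) + z) (fall-phase n 0ℚ (- β) _ bottom ≤-refl ≤-refl) ⟩
      n · L + ((- β) * (- β) - 0ℚ * 0ℚ) + (n · L + (0ℚ * 0ℚ - (- β) * (- β)) + two * fracCost (- β) (zigzag m))
        ≡⟨ round-trip (n · L) (- β) (two * fracCost (- β) (zigzag m)) ⟩
      two * (n · L) + two * fracCost (- β) (zigzag m) ∎
      where
      open ≡-Reasoning
      top : 0ℚ ≡ - β + n · ε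
      top = sym (trans (cong (λ x → - β + x) nε≡β) (+-inverseˡ β))
      bottom : - β ≡ 0ℚ - n · ε
      bottom = sym (trans (cong (λ x → 0ℚ - x) nε≡β) (+-identityˡ (- β)))
      round-trip : ∀ l d x → l + (d * d - 0ℚ * 0ℚ) + (l + (0ℚ * 0ℚ - d * d) + x) ≡ two * l + x
      round-trip = solve-∀ ℚ-ring

    ExpCost-zigzag : ∀ m → ExpCost (zigzag m) ≡ (two * β - ε) * (m · 1ℚ)
    ExpCost-zigzag m = *-cancelˡ-≡-pos (two * β) 0<2β (begin
      two * β * ExpCost (zigzag m)            ≡⟨ *-assoc two β _ ⟩
      two * (β * ExpCost (zigzag m))          ≡⟨ cong (two *_) (βExpCost (zigzag m)) ⟩
      two * fracCost (- β) (zigzag m)         ≡⟨ rounds m ⟩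
      m · (two * (n · L))                     ≡⟨ ·-as-* m _ ⟩
      two * (n · L) * (m · 1ℚ)                ≡⟨ cong (λ x → two * x * (m · 1ℚ)) nL≡ ⟩
      two * (β * (two * β - ε)) * (m · 1ℚ)    ≡⟨ regroup two β (two * β - ε) (m · 1ℚ) ⟩
      two * β * ((two * β - ε) * (m · 1ℚ))    ∎)
      where
      open ≡-Reasoning
      rounds : ∀ m → two * fracCost (- β) (zigzag m) ≡ m · (two * (n · L))
      rounds zero    = refl
      rounds (suc m) = trans (round-cost m) (cong (λ z → two * (n · L) + z) (rounds m))
      regroup : ∀ t b x M → t * (b * x) * M ≡ t * b * (x * M)
      regroup = solve-∀ ℚ-ring

    -- Staying in state 0 costs β per round, so Opt ≤ m·β.
    Opt-zigzag : ∀ m → Opt (zigzag m) ≤ β * (m · 1ℚ)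
    Opt-zigzag m = subst (Opt (zigzag m) ≤_) (trans (idle-zigzag m) (·-as-* m β)) (Opt≤idle (zigzag m))
      where
      idle-zigzag : ∀ m → idle (zigzag m) ≡ m · β
      idle-zigzag zero    = refl
      idle-zigzag (suc m) = begin
        idle (replicate n rise ++ (replicate n fall ++ zigzag m))
          ≡⟨ idle-++ (replicate n rise) _ ⟩
        idle (replicate n rise) + idle (replicate n fall ++ zigzag m)
          ≡⟨ cong (λ z → idle (replicate n rise) + z) (idle-++ (replicate n fall) (zigzag m)) ⟩
        idle (replicate n rise) + (idle (replicate n fall) + idle (zigzag m))
          ≡⟨ cong₂ (λ x y → x + (y + idle (zigzag m))) (idle-replicate n ε 0ℚ) (idle-replicate n 0ℚ ε) ⟩
        n · ε + (n · 0ℚ + idle (zigzag m))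
          ≡⟨ cong₂ (λ x y → x + (y + idle (zigzag m))) nε≡β (·-zero n) ⟩
        β + (0ℚ + idle (zigzag m))
          ≡⟨ cong (λ x → β + x) (trans (+-identityˡ _) (idle-zigzag m)) ⟩
        suc m · β ∎
        where open ≡-Reasoning

    zigzag-excess : ∀ c' γ → (∀ σs → All Nonneg σs → ExpCost σs ≤ c' * Opt σs + γ) →
                    ∀ m → ((two - (c' ⊔ 0ℚ)) * β - ε) * (m · 1ℚ) ≤ γ
    zigzag-excess c' γ bound m = +-cancelˡ-≤ (d * (β * M)) (begin
      d * (β * M) + ((two - d) * β - ε) * M  ≡⟨ regroup d β ε M ⟩
      (two * β - ε) * M                      ≡⟨ sym (ExpCost-zigzag m) ⟩
      ExpCost σs                             ≤⟨ bound σs nn ⟩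
      c' * Opt σs + γ                        ≤⟨ +-monoˡ-≤ γ (*-monoʳ-≤-nonNeg (Opt σs) {{nonNegative (Opt-nonneg σs nn)}} (p≤p⊔q c' 0ℚ)) ⟩
      d * Opt σs + γ                         ≤⟨ +-monoˡ-≤ γ (*-monoˡ-≤-nonNeg d {{nonNegative (p≤q⊔p c' 0ℚ)}} (Opt-zigzag m)) ⟩
      d * (β * M) + γ                        ∎)
      where
      open ≤-Reasoning
      d = c' ⊔ 0ℚ
      M = m · 1ℚ
      σs = zigzag m
      nn = zigzag-nonneg m
      regroup : ∀ d b e M → d * (b * M) + ((two - d) * b - e) * M ≡ (two * b - e) * M
      regroup = solve-∀ ℚ-ring

  fine-resolution : ∀ r → 0ℚ < r → ∃[ n ] ∃[ ε ] (0ℚ < ε) × (n · ε ≡ β) × (two * ε ≤ r * β)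
  fine-resolution r 0<r = n , ε , 0<ε , trans (·-as-* n ε) εN≡β , 2ε≤rβ
    where
    -- n is chosen with 2 < r·n, and ε = β/n
    n = proj₁ (archimedean-scaled r two 0<r)
    2<rN = proj₂ (archimedean-scaled r two 0<r)
    N = n · 1ℚ
    0<N : 0ℚ < N
    0<N = *-cancelˡ-<-nonNeg r {{nonNegative (<⇒≤ 0<r)}}
            (subst (_< r * N) (sym (*-zeroʳ r)) (<-trans 0<two 2<rN))
    instance _ = >-nonZero 0<N
    ε = β * 1/ N
    εN≡β : ε * N ≡ β
    εN≡β = trans (*-assoc β (1/ N) N) (trans (cong (β *_) (*-inverseˡ N)) (*-identityʳ β))
    0<ε : 0ℚ < ε
    0<ε = *-cancelʳ-<-nonNeg N {{nonNegative (<⇒≤ 0<N)}} (subst₂ _<_ (sym (*-zeroˡ N)) (sym εN≡β) 0<β)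
    2ε≤rβ : two * ε ≤ r * β
    2ε≤rβ = begin
      two * ε        ≤⟨ *-monoʳ-≤-nonNeg ε {{nonNegative (<⇒≤ 0<ε)}} (<⇒≤ 2<rN) ⟩
      r * N * ε      ≡⟨ regroup r N ε ⟩
      r * (ε * N)    ≡⟨ cong (r *_) εN≡β ⟩
      r * β          ∎
      where
      open ≤-Reasoning
      regroup : ∀ r N e → r * N * e ≡ r * (e * N)
      regroup = solve-∀ ℚ-ring

  -- With r = 2 - max(c', 0) > 0, pick a
  -- resolution ε with 2ε ≤ rβ and then m with γ < ε·m; the zigzag input of m rounds
  -- then forces ε·m ≤ (rβ - ε)·m ≤ γ.
  lower : ∀ c' → c' < two → ¬ Competitive c'
  lower c' c'<2 (γ , bound) =
    let (n , ε , 0<ε , nε≡β , 2ε≤rβ) = fine-resolution r 0<r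
        (m , γ<εm) = archimedean-scaled ε γ 0<ε
    in <-irrefl refl (<-≤-trans γ<εm (≤-trans (room-for-ε m 2ε≤rβ)
                                              (Zigzag.zigzag-excess ε 0<ε n nε≡β c' γ bound m)))
    where
    d = c' ⊔ 0ℚ
    r = two - d
    d<2 : d < two
    d<2 with ⊔-sel c' 0ℚ
    ... | inj₁ d≡c' = subst (_< two) (sym d≡c') c'<2
    ... | inj₂ d≡0  = subst (_< two) (sym d≡0) 0<two
    0<r : 0ℚ < r
    0<r = subst (_< r) (+-inverseʳ d) (+-monoˡ-< (- d) d<2)

theorem5 : (β H : ℚ) → 0ℚ < β → SP.RatioIs β H (+ 2 / 1)
theorem5 β H 0<β = upper , lower
  where open Chase β H 0<β
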